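{- Let $n\equiv 1,3\pmod 6$ and $u\ge 0$. If there exists a $3$-sun system of order $n+u$ into which a Steiner triple system of order $n$ is embedded, then $u\geq \frac{n-1}{2}$.
   Context: All graphs are simple and finite. For a graph $G$, a $G$-design of order $n$ is a pair $(X,\mathcal{B})$ where $|X|=n$ and $\mathcal{B}$ is a collection of subgraphs of the complete graph $K_n$ on $X$ (blocks), each isomorphic to $G$, whose edge sets partition the edge set of $K_n$. A Steiner triple system of order $n$ is a $K_3$-design of order $n$. A $3$-sun is the graph on six vertices consisting of a triangle $\{a,b,c\}$ with three pendant edges $\{a,d\},\{b,e\},\{c,f\}$; a $3$-sun system of order $m$ is a $3$-sun-design of order $m$. A $K_3$-design $(X,\mathcal{B})$ of order $n$ is embedded into a $3$-sun design $(X\cup U,\mathcal{C})$ of order $n+u$ (with $X\cap U=\emptyset$, $|U|=u$) if there is an injective map $f:\mathcal{B}\to\mathcal{C}$ such that $B$ is a subgraph of $f(B)$ for every $B\in\mathcal{B}$. -}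

module Defs where

open import Data.Nat using (ℕ; _+_)
open import Data.Fin using (Fin; _↑ˡ_)
open import Data.Product using (Σ; _×_; _,_)
open import Data.Sum using (_⊎_)
open import Relation.Binary.PropositionalEquality using (_≡_; _≢_)
open import Function.Definitions using (Injective)

SameEdge : ∀ {m} → Fin m → Fin m → Fin m → Fin m → Set
SameEdge x y p q = (x ≡ p × y ≡ q) ⊎ (x ≡ q × y ≡ p)

record Triangle (m : ℕ) : Set where
  constructor tri
  field
    a b c : Fin m
    a≢b : a ≢ b
    a≢c : a ≢ c
    b≢c : b ≢ c

TriEdge : ∀ {m} → Triangle m → Fin m → Fin m → Set
TriEdge t x y = SameEdge x y a b ⊎ SameEdge x y b c ⊎ SameEdge x y c a
  where open Triangle t

record Sun (m : ℕ) : Set where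
  constructor sun
  field
    a b c d e f : Fin m
    a≢b : a ≢ b
    a≢c : a ≢ c
    a≢d : a ≢ d
    a≢e : a ≢ e
    a≢f : a ≢ f
    b≢c : b ≢ c
    b≢d : b ≢ d
    b≢e : b ≢ e
    b≢f : b ≢ f
    c≢d : c ≢ d
    c≢e : c ≢ e
    c≢f : c ≢ f
    d≢e : d ≢ e
    d≢f : d ≢ f
    e≢f : e ≢ f

SunEdge : ∀ {m} → Sun m → Fin m → Fin m → Set
SunEdge s x y =
  SameEdge x y a b ⊎ SameEdge x y b c ⊎ SameEdge x y c a ⊎
  SameEdge x y a d ⊎ SameEdge x y b e ⊎ SameEdge x y c f
  where open Sun s

IsDesign : ∀ {m : ℕ} {Blk : Set} (Edge : Blk → Fin m → Fin m → Set)
           (k : ℕ) (B : Fin k → Blk) → Set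
IsDesign {m} Edge k B =
  ((x y : Fin m) → x ≢ y → Σ (Fin k) (λ i → Edge (B i) x y)) ×
  ((x y : Fin m) → (i j : Fin k) → Edge (B i) x y → Edge (B j) x y → i ≡ j)

record STS (n : ℕ) : Set where
  field
    k : ℕ
    blocks : Fin k → Triangle n
    isDesign : IsDesign TriEdge k blocks

record SunSystem (m : ℕ) : Set where
  field
    k : ℕ
    blocks : Fin k → Sun m
    isDesign : IsDesign SunEdge k blocks

-- Embedding an STS on X = Fin n into a 3-sun system on X ∪ U = Fin (n + u)
-- (X identified with the first n vertices via _↑ˡ_, U the last u):
-- an injective map f from STS blocks to sun blocks with B a subgraph of f(B),
-- i.e. every edge of B is an edge of f(B).
Embeds : ∀ {n} u → STS n → SunSystem (n + u) → Set
Embeds {n} u S C =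
  Σ (Fin (STS.k S) → Fin (SunSystem.k C)) λ f →
    Injective _≡_ _≡_ f ×
    ((i : Fin (STS.k S)) (x y : Fin n) →
      TriEdge (STS.blocks S i) x y →
      SunEdge (SunSystem.blocks C (f i)) (x ↑ˡ u) (y ↑ˡ u))

-- Call the n vertices of the triple system old and the u others new, and fix
-- an old vertex x. By uniqueness, an edge of the sun system joining two
-- old vertices lies in the sun into which its triple embeds, and there it is an
-- edge of the central triangle, because a 3-sun contains no other triangle.
-- So x is a central vertex of the sun containing an edge xy with y old, and its
-- pendant partner there is a new vertex v (an old one would make the pendant
-- edge central). That sun is the only one containing xv, and besides x its
-- central triangle has just two vertices, so y ↦ (v, which of the two) is
-- injective and n − 1 ≤ 2u.
module Submission where

open import Defs
open import Data.Nat using (ℕ; _+_; _∸_; _≤_; _%_; _/_; zero; suc; _*_; z≤n)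
open import Data.Sum using (_⊎_; inj₁; inj₂)
open import Data.Product using (Σ; _,_; _×_)
open import Data.Nat.Properties using (module ≤-Reasoning)
open import Data.Nat.DivMod using (/-monoˡ-≤; m*n/n≡m)
open import Data.Fin using (Fin; _↑ˡ_; _↑ʳ_; splitAt; combine; punchOut)
  renaming (zero to fz; suc to fs)
open import Data.Fin.Properties
  using (↑ˡ-injective; splitAt⁻¹-↑ˡ; splitAt⁻¹-↑ʳ; combine-injective; injective⇒≤;
         suc-injective; punchOut-injective)
import Data.Sum as Sum
import Data.Product as Product
open import Data.Empty using (⊥-elim)
open import Relation.Binary.PropositionalEquality
  using (_≡_; refl; sym; trans; cong; subst₂; _≢_; module ≡-Reasoning)
open import Function using (_∘_)
open import Function.Definitions using (Injective)

sameEdge-sym : ∀ {m} {x y p q : Fin m} → SameEdge x y p q → SameEdge y x p q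
sameEdge-sym = Sum.swap ∘ Sum.map Product.swap Product.swap

triEdge-third : ∀ {n} (t : Triangle n) {x y} → TriEdge t x y →
                Σ (Fin n) λ z → y ≢ z × z ≢ x × TriEdge t y z × TriEdge t z x
triEdge-third (tri a b c a≢b a≢c b≢c) (inj₁ (inj₁ (refl , refl))) =
  c , b≢c , a≢c ∘ sym , inj₂ (inj₁ (inj₁ (refl , refl))) , inj₂ (inj₂ (inj₁ (refl , refl)))
triEdge-third (tri a b c a≢b a≢c b≢c) (inj₁ (inj₂ (refl , refl))) =
  c , a≢c , b≢c ∘ sym , inj₂ (inj₂ (inj₂ (refl , refl))) , inj₂ (inj₁ (inj₂ (refl , refl)))
triEdge-third (tri a b c a≢b a≢c b≢c) (inj₂ (inj₁ (inj₁ (refl , refl)))) =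
  a , a≢c ∘ sym , a≢b , inj₂ (inj₂ (inj₁ (refl , refl))) , inj₁ (inj₁ (refl , refl))
triEdge-third (tri a b c a≢b a≢c b≢c) (inj₂ (inj₁ (inj₂ (refl , refl)))) =
  a , a≢b ∘ sym , a≢c , inj₁ (inj₂ (refl , refl)) , inj₂ (inj₂ (inj₂ (refl , refl)))
triEdge-third (tri a b c a≢b a≢c b≢c) (inj₂ (inj₂ (inj₁ (refl , refl)))) =
  b , a≢b , b≢c , inj₁ (inj₁ (refl , refl)) , inj₂ (inj₁ (inj₁ (refl , refl)))
triEdge-third (tri a b c a≢b a≢c b≢c) (inj₂ (inj₂ (inj₂ (refl , refl)))) =
  b , b≢c ∘ sym , a≢b ∘ sym , inj₂ (inj₁ (inj₂ (refl , refl))) , inj₁ (inj₂ (refl , refl))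

module _ {m : ℕ} (s : Sun m) where
  open Sun s

  central : Fin 3 → Fin m
  central fz = a
  central (fs fz) = b
  central (fs (fs fz)) = c

  pendant : Fin 3 → Fin m
  pendant fz = d
  pendant (fs fz) = e
  pendant (fs (fs fz)) = f

  central-injective : Injective _≡_ _≡_ central
  central-injective {fz}         {fz}         _ = refl
  central-injective {fz}         {fs fz}      p = ⊥-elim (a≢b p)
  central-injective {fz}         {fs (fs fz)} p = ⊥-elim (a≢c p)
  central-injective {fs fz}      {fz}         p = ⊥-elim (a≢b (sym p))
  central-injective {fs fz}      {fs fz}      _ = refl
  central-injective {fs fz}      {fs (fs fz)} p = ⊥-elim (b≢c p)
  central-injective {fs (fs fz)} {fz}         p = ⊥-elim (a≢c (sym p))
  central-injective {fs (fs fz)} {fs fz}      p = ⊥-elim (b≢c (sym p))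
  central-injective {fs (fs fz)} {fs (fs fz)} _ = refl

  pendant-injective : Injective _≡_ _≡_ pendant
  pendant-injective {fz}         {fz}         _ = refl
  pendant-injective {fz}         {fs fz}      p = ⊥-elim (d≢e p)
  pendant-injective {fz}         {fs (fs fz)} p = ⊥-elim (d≢f p)
  pendant-injective {fs fz}      {fz}         p = ⊥-elim (d≢e (sym p))
  pendant-injective {fs fz}      {fs fz}      _ = refl
  pendant-injective {fs fz}      {fs (fs fz)} p = ⊥-elim (e≢f p)
  pendant-injective {fs (fs fz)} {fz}         p = ⊥-elim (d≢f (sym p))
  pendant-injective {fs (fs fz)} {fs fz}      p = ⊥-elim (e≢f (sym p))
  pendant-injective {fs (fs fz)} {fs (fs fz)} _ = refl

  central≢pendant : ∀ π π′ → central π ≢ pendant π′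
  central≢pendant fz           fz           = a≢d
  central≢pendant fz           (fs fz)      = a≢e
  central≢pendant fz           (fs (fs fz)) = a≢f
  central≢pendant (fs fz)      fz           = b≢d
  central≢pendant (fs fz)      (fs fz)      = b≢e
  central≢pendant (fs fz)      (fs (fs fz)) = b≢f
  central≢pendant (fs (fs fz)) fz           = c≢d
  central≢pendant (fs (fs fz)) (fs fz)      = c≢e
  central≢pendant (fs (fs fz)) (fs (fs fz)) = c≢f

  CentralEdge : Fin m → Fin m → Set
  CentralEdge x y =
    Σ (Fin 3) λ π → Σ (Fin 3) λ π′ → π ≢ π′ × central π ≡ x × central π′ ≡ y

  PendantEdge : Fin m → Fin m → Set
  PendantEdge x y = Σ (Fin 3) λ π → SameEdge x y (central π) (pendant π)

  sunEdge-classify : ∀ {x y} → SunEdge s x y → CentralEdge x y ⊎ PendantEdge x y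
  sunEdge-classify (inj₁ (inj₁ (refl , refl))) = inj₁ (fz , fs fz , (λ ()) , refl , refl)
  sunEdge-classify (inj₁ (inj₂ (refl , refl))) = inj₁ (fs fz , fz , (λ ()) , refl , refl)
  sunEdge-classify (inj₂ (inj₁ (inj₁ (refl , refl)))) =
    inj₁ (fs fz , fs (fs fz) , (λ ()) , refl , refl)
  sunEdge-classify (inj₂ (inj₁ (inj₂ (refl , refl)))) =
    inj₁ (fs (fs fz) , fs fz , (λ ()) , refl , refl)
  sunEdge-classify (inj₂ (inj₂ (inj₁ (inj₁ (refl , refl))))) =
    inj₁ (fs (fs fz) , fz , (λ ()) , refl , refl)
  sunEdge-classify (inj₂ (inj₂ (inj₁ (inj₂ (refl , refl))))) =
    inj₁ (fz , fs (fs fz) , (λ ()) , refl , refl)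
  sunEdge-classify (inj₂ (inj₂ (inj₂ (inj₁ ad)))) = inj₂ (fz , ad)
  sunEdge-classify (inj₂ (inj₂ (inj₂ (inj₂ (inj₁ be))))) = inj₂ (fs fz , be)
  sunEdge-classify (inj₂ (inj₂ (inj₂ (inj₂ (inj₂ cf))))) = inj₂ (fs (fs fz) , cf)

  sunEdge-sym : ∀ {x y} → SunEdge s x y → SunEdge s y x
  sunEdge-sym = Sum.map sameEdge-sym (Sum.map sameEdge-sym (Sum.map sameEdge-sym
    (Sum.map sameEdge-sym (Sum.map sameEdge-sym sameEdge-sym))))

  pendantEdge : ∀ π → SunEdge s (central π) (pendant π)
  pendantEdge fz           = inj₂ (inj₂ (inj₂ (inj₁ (inj₁ (refl , refl)))))
  pendantEdge (fs fz)      = inj₂ (inj₂ (inj₂ (inj₂ (inj₁ (inj₁ (refl , refl))))))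
  pendantEdge (fs (fs fz)) = inj₂ (inj₂ (inj₂ (inj₂ (inj₂ (inj₁ (refl , refl))))))

  pendant-neighbour : ∀ {π y} → SunEdge s (pendant π) y → y ≡ central π
  pendant-neighbour {π} pe with sunEdge-classify pe
  ... | inj₁ (π₁ , _ , _ , c≡p , _) = ⊥-elim (central≢pendant π₁ π c≡p)
  ... | inj₂ (π₁ , inj₁ (p≡c , _)) = ⊥-elim (central≢pendant π₁ π (sym p≡c))
  ... | inj₂ (π₁ , inj₂ (p≡p , y≡c)) = trans y≡c (cong central (sym (pendant-injective {π} {π₁} p≡p)))

  sunTriangle-central : ∀ {p q r} → q ≢ r → r ≢ p →
    SunEdge s p q → SunEdge s q r → SunEdge s r p → CentralEdge p q
  sunTriangle-central q≢r r≢p pq qr rp with sunEdge-classify pq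
  ... | inj₁ central-pq = central-pq
  ... | inj₂ (π , inj₁ (refl , refl)) = ⊥-elim (r≢p (pendant-neighbour {π} qr))
  ... | inj₂ (π , inj₂ (refl , refl)) = ⊥-elim (q≢r (sym (pendant-neighbour {π} (sunEdge-sym rp))))

module SunEmbedding {n u : ℕ} (S : STS n) (C : SunSystem (n + u))
         (f : Fin (STS.k S) → Fin (SunSystem.k C))
         (subgraph : (i : Fin (STS.k S)) (x y : Fin n) → TriEdge (STS.blocks S i) x y →
                     SunEdge (SunSystem.blocks C (f i)) (x ↑ˡ u) (y ↑ˡ u))
  where
  private
    block : Fin (SunSystem.k C) → Sun (n + u)
    block = SunSystem.blocks C

    covered-by-triple : (x y : Fin n) → x ≢ y →
                        Σ (Fin (STS.k S)) λ j → TriEdge (STS.blocks S j) x y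
    covered-by-triple = Product.proj₁ (STS.isDesign S)

    covered-by-sun : (x y : Fin (n + u)) → x ≢ y →
                     Σ (Fin (SunSystem.k C)) λ i → SunEdge (block i) x y
    covered-by-sun = Product.proj₁ (SunSystem.isDesign C)

    unique-sun : (x y : Fin (n + u)) (i j : Fin (SunSystem.k C)) →
                 SunEdge (block i) x y → SunEdge (block j) x y → i ≡ j
    unique-sun = Product.proj₂ (SunSystem.isDesign C)

  old : Fin n → Fin (n + u)
  old x = x ↑ˡ u

  new : Fin u → Fin (n + u)
  new v = n ↑ʳ v

  old-injective : ∀ {x y} → x ≢ y → old x ≢ old y
  old-injective x≢y = x≢y ∘ ↑ˡ-injective u _ _

  oldEdge-central : ∀ i {x y} → x ≢ y →
    SunEdge (block i) (old x) (old y) → CentralEdge (block i) (old x) (old y)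
  oldEdge-central i {x} {y} x≢y e with covered-by-triple x y x≢y
  ... | j , xy with triEdge-third (STS.blocks S j) xy
  ...   | z , y≢z , z≢x , yz , zx
          with unique-sun (old x) (old y) i (f j) e (subgraph j x y xy)
  ...     | refl = sunTriangle-central (block i) (old-injective y≢z) (old-injective z≢x)
                     e (subgraph j y z yz) (subgraph j z x zx)

  oldCentral-pendant-not-old : ∀ i π {x w} → central (block i) π ≡ old x →
    pendant (block i) π ≢ old w
  oldCentral-pendant-not-old i π {x} {w} c≡x p≡w =
    let _ , π′ , _ , _ , c≡w = oldEdge-central i x≢w old-pendant-edge
    in  central≢pendant (block i) π′ π (trans c≡w (sym p≡w))
    where
      x≢w : x ≢ w
      x≢w x≡w = central≢pendant (block i) π π (trans c≡x (trans (cong old x≡w) (sym p≡w)))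
      old-pendant-edge : SunEdge (block i) (old x) (old w)
      old-pendant-edge = subst₂ (SunEdge (block i)) c≡x p≡w (pendantEdge (block i) π)

  oldCentral-newPendant : ∀ i π {x} → central (block i) π ≡ old x →
    Σ (Fin u) λ v → pendant (block i) π ≡ new v
  oldCentral-newPendant i π c≡x with splitAt n (pendant (block i) π) in split
  ... | inj₂ v = v , sym (splitAt⁻¹-↑ʳ split)
  ... | inj₁ w = ⊥-elim (oldCentral-pendant-not-old i π c≡x (sym (splitAt⁻¹-↑ˡ split)))

  record Spoke (x y : Fin n) : Set where
    field
      index : Fin (SunSystem.k C)
      here there : Fin 3
      here≢there : here ≢ there
      central-here : central (block index) here ≡ old x
      central-there : central (block index) there ≡ old y
      outer : Fin u
      pendant-here : pendant (block index) here ≡ new outer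

    pendantEdge-here : SunEdge (block index) (old x) (new outer)
    pendantEdge-here =
      subst₂ (SunEdge (block index)) central-here pendant-here (pendantEdge (block index) here)

    code : Fin (u * 2)
    code = combine outer (punchOut here≢there)

  open Spoke

  spoke : ∀ {x y} → x ≢ y → Spoke x y
  spoke {x} {y} x≢y =
    let i , e = covered-by-sun (old x) (old y) (old-injective x≢y)
        π , π′ , π≢π′ , c≡x , c′≡y = oldEdge-central i x≢y e
        v , p≡v = oldCentral-newPendant i π c≡x
    in  record { index = i ; here = π ; there = π′ ; here≢there = π≢π′
               ; central-here = c≡x ; central-there = c′≡y ; outer = v ; pendant-here = p≡v }

  outer-determines-index : ∀ {x y y′} (σ : Spoke x y) (σ′ : Spoke x y′) →
    outer σ ≡ outer σ′ → index σ ≡ index σ′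
  outer-determines-index σ σ′ refl =
    unique-sun _ _ (index σ) (index σ′) (pendantEdge-here σ) (pendantEdge-here σ′)

  code-injective : ∀ {x y y′} (σ : Spoke x y) (σ′ : Spoke x y′) →
    code σ ≡ code σ′ → y ≡ y′
  code-injective σ σ′ same-code
    with combine-injective (outer σ) (punchOut (here≢there σ))
                           (outer σ′) (punchOut (here≢there σ′)) same-code
  ... | same-outer , same-punchOut with outer-determines-index σ σ′ same-outer
  ...   | refl with central-injective (block (index σ)) {here σ} {here σ′}
                     (trans (central-here σ) (sym (central-here σ′)))
  ...     | refl = ↑ˡ-injective u _ _ (begin
    old _                                ≡⟨ sym (central-there σ) ⟩
    central (block (index σ)) (there σ)  ≡⟨ cong (central (block (index σ))) same-there ⟩
    central (block (index σ)) (there σ′) ≡⟨ central-there σ′ ⟩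
    old _                                ∎)
    where
      open ≡-Reasoning
      same-there : there σ ≡ there σ′
      same-there = punchOut-injective (here≢there σ) (here≢there σ′) same-punchOut

embedded-order-bound : ∀ {n′ u} (S : STS (suc n′)) (C : SunSystem (suc n′ + u)) →
  Embeds u S C → n′ ≤ u * 2
embedded-order-bound {n′} {u} S C (f , _ , subgraph) =
  injective⇒≤ {f = spoke-code} (suc-injective ∘ code-injective (spoke λ ()) (spoke λ ()))
  where
    open SunEmbedding S C f subgraph
    open Spoke using (code)
    spoke-code : Fin n′ → Fin (u * 2)
    spoke-code y = code (spoke {fz} {fs y} λ ())

-- The congruence condition only guarantees that an STS of order n exists.
lemma2p1 : (n u : ℕ) → (n % 6 ≡ 1 ⊎ n % 6 ≡ 3) →
           (S : STS n) → Σ (SunSystem (n + u)) (λ C → Embeds u S C) →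
           (n ∸ 1) / 2 ≤ u
lemma2p1 zero     u _ S _ = z≤n
lemma2p1 (suc n′) u _ S (C , embedding) = begin
  n′ / 2      ≤⟨ /-monoˡ-≤ 2 (embedded-order-bound S C embedding) ⟩
  u * 2 / 2   ≡⟨ m*n/n≡m u 2 ⟩
  u           ∎
  where open ≤-Reasoning
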